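{- For all formulas $A,B$: if the sequent $\Rightarrow A\vee B$ is provable in $\mathbf{C}_{\mathbf{LIKD}^- }$ (resp. $\mathbf{C}_{\mathbf{LIKT}^- }$), then $\Rightarrow A$ or $\Rightarrow B$ is provable in $\mathbf{C}_{\mathbf{LIKD}^- }$ (resp. $\mathbf{C}_{\mathbf{LIKT}^- }$).
   Context: Formulas: $A::=p\mid A\supset A\mid \top\mid\bot\mid A\vee A\mid A\wedge A\mid \square A\mid \lozenge A$. Bi-nested sequents: the empty sequent $\Rightarrow$ is a sequent; $\Gamma\Rightarrow B_1,\dots,B_k,[S_1],\dots,[S_m],\langle T_1\rangle,\dots,\langle T_n\rangle$ is a sequent, where $\Gamma$ is a finite multiset of formulas, $B_i$ formulas, $S_i,T_j$ sequents ($[S]$: modal block, $\langle T\rangle$: implication block). Contexts: $\{\}$ is a context; if $\Gamma\Rightarrow\Delta$ is a sequent and $G'\{\}$ a context then $\Gamma\Rightarrow\Delta,\langle G'\{\}\rangle$ and $\Gamma\Rightarrow\Delta,[G'\{\}]$ are contexts; $G\{S\}$ fills the hole with $S$. For a succedent $\Theta=\Theta_0,[\Phi_1\Rightarrow\Psi_1],\dots,[\Phi_k\Rightarrow\Psi_k]$ with $\Theta_0$ containing no modal blocks at top level, $\Theta^\flat=[\Phi_1\Rightarrow\Psi_1^\flat],\dots,[\Phi_k\Rightarrow\Psi_k^\flat]$ (empty if $k=0$). Rules of $\mathbf{C}_{\mathbf{LIK}^- }$ (premises / conclusion, $G$ any context): axioms $G\{\Gamma,\bot\Rightarrow\Delta\}$,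 $G\{\Gamma\Rightarrow\top,\Delta\}$, $G\{\Gamma,p\Rightarrow\Delta,p\}$ ($p$ atom); $(\wedge_L)$ $G\{A,B,\Gamma\Rightarrow\Delta\}$ / $G\{A\wedge B,\Gamma\Rightarrow\Delta\}$; $(\wedge_R)$ $G\{\Gamma\Rightarrow\Delta,A\}$, $G\{\Gamma\Rightarrow\Delta,B\}$ / $G\{\Gamma\Rightarrow\Delta,A\wedge B\}$; $(\vee_L)$ $G\{\Gamma,A\Rightarrow\Delta\}$, $G\{\Gamma,B\Rightarrow\Delta\}$ / $G\{\Gamma,A\vee B\Rightarrow\Delta\}$; $(\vee_R)$ $G\{\Gamma\Rightarrow\Delta,A,B\}$ / $G\{\Gamma\Rightarrow\Delta,A\vee B\}$; $(\supset_L)$ $G\{\Gamma,A\supset B\Rightarrow A,\Delta\}$, $G\{\Gamma,B\Rightarrow\Delta\}$ / $G\{\Gamma,A\supset B\Rightarrow\Delta\}$; $(\supset_R)$ $G\{\Gamma\Rightarrow\Delta,\langle A\Rightarrow B\rangle\}$ / $G\{\Gamma\Rightarrow\Delta,A\supset B\}$; $(\square_L)$ $G\{\Gamma,\square A\Rightarrow\Delta,[\Sigma,A\Rightarrow\Pi]\}$ / $G\{\Gamma,\square A\Rightarrow\Delta,[\Sigma\Rightarrow\Pi]\}$; $(\square_R)$ $G\{\Gamma\Rightarrow\Delta,[\Rightarrow A]\}$ / $G\{\Gamma\Rightarrow\Delta,\square A\}$; $(\lozenge_L)$ $G\{\Gamma\Rightarrow\Delta,[A\Rightarrow]\}$ /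 $G\{\Gamma,\lozenge A\Rightarrow\Delta\}$; $(\lozenge_R)$ $G\{\Gamma\Rightarrow\Delta,\lozenge A,[\Sigma\Rightarrow\Pi,A]\}$ / $G\{\Gamma\Rightarrow\Delta,\lozenge A,[\Sigma\Rightarrow\Pi]\}$; (trans) $G\{\Gamma,\Gamma'\Rightarrow\Delta,\langle\Gamma',\Sigma\Rightarrow\Pi\rangle\}$ / $G\{\Gamma,\Gamma'\Rightarrow\Delta,\langle\Sigma\Rightarrow\Pi\rangle\}$; $(\mathrm{inter}_\rightarrow)$ $G\{\Gamma\Rightarrow\Delta,\langle\Sigma\Rightarrow\Pi,[\Lambda\Rightarrow\Theta^\flat]\rangle,[\Lambda\Rightarrow\Theta]\}$ / $G\{\Gamma\Rightarrow\Delta,\langle\Sigma\Rightarrow\Pi\rangle,[\Lambda\Rightarrow\Theta]\}$. $\mathbf{C}_{\mathbf{LIKD}^- }$ adds $(\mathbf{D})$: $G\{\Gamma\Rightarrow\Delta,[\Rightarrow]\}$ / $G\{\Gamma\Rightarrow\Delta\}$. $\mathbf{C}_{\mathbf{LIKT}^- }$ adds $(\mathbf{T}_\square)$: $G\{\Gamma,\square A,A\Rightarrow\Delta\}$ / $G\{\Gamma,\square A\Rightarrow\Delta\}$ and $(\mathbf{T}_\lozenge)$: $G\{\Gamma\Rightarrow\Delta,\lozenge A,A\}$ / $G\{\Gamma\Rightarrow\Delta,\lozenge A\}$. A sequent is provable if it is the root of a finite tree of rule instances whose leaves are axioms. -}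

module Defs where

open import Data.Nat using (ℕ)
open import Data.List using (List; []; _∷_; _++_)
open import Data.List.Relation.Binary.Permutation.Propositional using (_↭_)
open import Relation.Binary.PropositionalEquality using (_≡_)

infixr 8 _∧_
infixr 7 _∨_
infixr 6 _⊃_
infix  3 _⇒_
infix  9 □_ ◇_

data Fml : Set where
  atom : ℕ → Fml
  _⊃_  : Fml → Fml → Fml
  top  : Fml
  bot  : Fml
  _∨_  : Fml → Fml → Fml
  _∧_  : Fml → Fml → Fml
  □_   : Fml → Fml
  ◇_   : Fml → Fml

-- Antecedent: multiset of formulas (a list, taken up to
-- permutation via _≈S_ below).  Succedent: multiset of items, each a formula,
-- a modal block [S] or an implication block ⟨T⟩.
mutual
  data Seq : Set where
    _⇒_ : List Fml → List Item → Seq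

  data Item : Set where
    fm  : Fml → Item
    box : Seq → Item
    imp : Seq → Item

mutual
  data _≈S_ : Seq → Seq → Set where
    seq≈ : ∀ {Γ Γ' Δ Δ'} → Γ ↭ Γ' → Δ ≈L Δ' → (Γ ⇒ Δ) ≈S (Γ' ⇒ Δ')

  data _≈I_ : Item → Item → Set where
    fm≈  : ∀ {A} → fm A ≈I fm A
    box≈ : ∀ {S S'} → S ≈S S' → box S ≈I box S'
    imp≈ : ∀ {S S'} → S ≈S S' → imp S ≈I imp S'

  data _≈L_ : List Item → List Item → Set where
    nil≈   : [] ≈L []
    cons≈  : ∀ {i j xs ys} → i ≈I j → xs ≈L ys → (i ∷ xs) ≈L (j ∷ ys)
    swap≈  : ∀ {x y xs} → (x ∷ y ∷ xs) ≈L (y ∷ x ∷ xs)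
    trans≈ : ∀ {xs ys zs} → xs ≈L ys → ys ≈L zs → xs ≈L zs

data Ctx : Set where
  hole  : Ctx
  inBox : List Fml → List Item → Ctx → Ctx
  inImp : List Fml → List Item → Ctx → Ctx

fill : Ctx → Seq → Seq
fill hole          S = S
fill (inBox Γ Δ G) S = Γ ⇒ Δ ++ (box (fill G S) ∷ [])
fill (inImp Γ Δ G) S = Γ ⇒ Δ ++ (imp (fill G S) ∷ [])

flat : List Item → List Item
flat []                  = []
flat (fm _ ∷ Θ)          = flat Θ
flat (imp _ ∷ Θ)         = flat Θ
flat (box (Φ ⇒ Ψ) ∷ Θ)   = box (Φ ⇒ flat Ψ) ∷ flat Θ

data Logic : Set where
  LIKD LIKT : Logic

data Prov (L : Logic) : Seq → Set where
  ax⊥ : ∀ {G Γ Δ} → Prov L (fill G (bot ∷ Γ ⇒ Δ))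
  ax⊤ : ∀ {G Γ Δ} → Prov L (fill G (Γ ⇒ fm top ∷ Δ))
  axp : ∀ {G Γ Δ p} → Prov L (fill G (atom p ∷ Γ ⇒ fm (atom p) ∷ Δ))
  ∧L  : ∀ {G Γ Δ A B} → Prov L (fill G (A ∷ B ∷ Γ ⇒ Δ))
      → Prov L (fill G (A ∧ B ∷ Γ ⇒ Δ))
  ∧R  : ∀ {G Γ Δ A B} → Prov L (fill G (Γ ⇒ fm A ∷ Δ)) → Prov L (fill G (Γ ⇒ fm B ∷ Δ))
      → Prov L (fill G (Γ ⇒ fm (A ∧ B) ∷ Δ))
  ∨L  : ∀ {G Γ Δ A B} → Prov L (fill G (A ∷ Γ ⇒ Δ)) → Prov L (fill G (B ∷ Γ ⇒ Δ))
      → Prov L (fill G (A ∨ B ∷ Γ ⇒ Δ))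
  ∨R  : ∀ {G Γ Δ A B} → Prov L (fill G (Γ ⇒ fm A ∷ fm B ∷ Δ))
      → Prov L (fill G (Γ ⇒ fm (A ∨ B) ∷ Δ))
  ⊃L  : ∀ {G Γ Δ A B} → Prov L (fill G ((A ⊃ B) ∷ Γ ⇒ fm A ∷ Δ))
      → Prov L (fill G (B ∷ Γ ⇒ Δ))
      → Prov L (fill G ((A ⊃ B) ∷ Γ ⇒ Δ))
  ⊃R  : ∀ {G Γ Δ A B} → Prov L (fill G (Γ ⇒ imp (A ∷ [] ⇒ fm B ∷ []) ∷ Δ))
      → Prov L (fill G (Γ ⇒ fm (A ⊃ B) ∷ Δ))
  □L  : ∀ {G Γ Δ Σ Π A} → Prov L (fill G ((□ A) ∷ Γ ⇒ box (A ∷ Σ ⇒ Π) ∷ Δ))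
      → Prov L (fill G ((□ A) ∷ Γ ⇒ box (Σ ⇒ Π) ∷ Δ))
  □R  : ∀ {G Γ Δ A} → Prov L (fill G (Γ ⇒ box ([] ⇒ fm A ∷ []) ∷ Δ))
      → Prov L (fill G (Γ ⇒ fm (□ A) ∷ Δ))
  ◇L  : ∀ {G Γ Δ A} → Prov L (fill G (Γ ⇒ box (A ∷ [] ⇒ []) ∷ Δ))
      → Prov L (fill G ((◇ A) ∷ Γ ⇒ Δ))
  ◇R  : ∀ {G Γ Δ Σ Π A} → Prov L (fill G (Γ ⇒ fm (◇ A) ∷ box (Σ ⇒ fm A ∷ Π) ∷ Δ))
      → Prov L (fill G (Γ ⇒ fm (◇ A) ∷ box (Σ ⇒ Π) ∷ Δ))
  trans : ∀ {G Γ Γ' Δ Σ Π} → Prov L (fill G (Γ ++ Γ' ⇒ imp (Γ' ++ Σ ⇒ Π) ∷ Δ))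
      → Prov L (fill G (Γ ++ Γ' ⇒ imp (Σ ⇒ Π) ∷ Δ))
  inter→ : ∀ {G Γ Δ Σ Π Λ Θ}
      → Prov L (fill G (Γ ⇒ imp (Σ ⇒ box (Λ ⇒ flat Θ) ∷ Π) ∷ box (Λ ⇒ Θ) ∷ Δ))
      → Prov L (fill G (Γ ⇒ imp (Σ ⇒ Π) ∷ box (Λ ⇒ Θ) ∷ Δ))
  D   : ∀ {G Γ Δ} → L ≡ LIKD → Prov L (fill G (Γ ⇒ box ([] ⇒ []) ∷ Δ))
      → Prov L (fill G (Γ ⇒ Δ))
  T□  : ∀ {G Γ Δ A} → L ≡ LIKT → Prov L (fill G ((□ A) ∷ A ∷ Γ ⇒ Δ))
      → Prov L (fill G ((□ A) ∷ Γ ⇒ Δ))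
  T◇  : ∀ {G Γ Δ A} → L ≡ LIKT → Prov L (fill G (Γ ⇒ fm (◇ A) ∷ fm A ∷ Δ))
      → Prov L (fill G (Γ ⇒ fm (◇ A) ∷ Δ))
  -- sequents are built from multisets
  perm : ∀ {S S'} → S ≈S S' → Prov L S → Prov L S'

-- Label each item in the succedent along the spine of a sequent (the sequent and, recursively, its modal
-- blocks) with a side, left or right, splitting the end formula A ∨ B into A on the left and B on the right.
-- By induction on a derivation, the restriction of the sequent to one of the two sides is derivable: a rule
-- acting inside an implication block is kept or dropped together with that block, and a rule on the spine
-- restricts componentwise, except that dropping □ A from the conclusion of (□R) leaves an empty block [⇒],
-- which (D) removes. So ⇒ A or ⇒ B is derivable once (D) is added. In LIKD that is the calculus itself; in
-- LIKT, (D) is admissible, because with T every modal block can be merged into its parent ((□L) becoming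
-- (T□) and (◇R) becoming (T◇)), and merging the block [⇒] introduced by (D) makes it vanish.

module Submission where

open import Defs
open import Data.Bool using (Bool; true; false)
open import Data.Empty using (⊥; ⊥-elim)
open import Data.List using (List; []; _∷_; _++_)
open import Data.List.Properties using (++-assoc; ++-identityʳ)
open import Data.List.Relation.Binary.Permutation.Propositional using (_↭_; ↭-refl; ↭-sym; ↭-trans; ↭-reflexive; prep)
open import Data.List.Relation.Binary.Permutation.Propositional.Properties
  using (++⁺ˡ; ++⁺ʳ; ++⁺; ++-comm; ↭-empty-inv; shift; shifts)
open import Data.Product using (Σ; ∃; _×_; _,_)
open import Data.Sum using (_⊎_; inj₁; inj₂)
open import Data.Unit using (⊤; tt)
open import Function using (id; _∘_)
open import Relation.Binary.PropositionalEquality using (_≡_; _≢_; refl; sym; cong; cong₂; subst)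
  renaming (trans to ≡-trans)
open import Relation.Nullary using (Dec; yes; no)

-- The rules of Prov with the side conditions of (D) and of (T□), (T◇) abstracted, so that (D) can be
-- added to C_LIKT^- and then eliminated again.
data Der (HasD HasT : Set) : Seq → Set where
  ax⊥ : ∀ {G Γ Δ} → Der HasD HasT (fill G (bot ∷ Γ ⇒ Δ))
  ax⊤ : ∀ {G Γ Δ} → Der HasD HasT (fill G (Γ ⇒ fm top ∷ Δ))
  axp : ∀ {G Γ Δ p} → Der HasD HasT (fill G (atom p ∷ Γ ⇒ fm (atom p) ∷ Δ))
  ∧L  : ∀ {G Γ Δ A B} → Der HasD HasT (fill G (A ∷ B ∷ Γ ⇒ Δ))
      → Der HasD HasT (fill G (A ∧ B ∷ Γ ⇒ Δ))
  ∧R  : ∀ {G Γ Δ A B} → Der HasD HasT (fill G (Γ ⇒ fm A ∷ Δ)) → Der HasD HasT (fill G (Γ ⇒ fm B ∷ Δ))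
      → Der HasD HasT (fill G (Γ ⇒ fm (A ∧ B) ∷ Δ))
  ∨L  : ∀ {G Γ Δ A B} → Der HasD HasT (fill G (A ∷ Γ ⇒ Δ)) → Der HasD HasT (fill G (B ∷ Γ ⇒ Δ))
      → Der HasD HasT (fill G (A ∨ B ∷ Γ ⇒ Δ))
  ∨R  : ∀ {G Γ Δ A B} → Der HasD HasT (fill G (Γ ⇒ fm A ∷ fm B ∷ Δ))
      → Der HasD HasT (fill G (Γ ⇒ fm (A ∨ B) ∷ Δ))
  ⊃L  : ∀ {G Γ Δ A B} → Der HasD HasT (fill G ((A ⊃ B) ∷ Γ ⇒ fm A ∷ Δ))
      → Der HasD HasT (fill G (B ∷ Γ ⇒ Δ))
      → Der HasD HasT (fill G ((A ⊃ B) ∷ Γ ⇒ Δ))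
  ⊃R  : ∀ {G Γ Δ A B} → Der HasD HasT (fill G (Γ ⇒ imp (A ∷ [] ⇒ fm B ∷ []) ∷ Δ))
      → Der HasD HasT (fill G (Γ ⇒ fm (A ⊃ B) ∷ Δ))
  □L  : ∀ {G Γ Δ Σ Π A} → Der HasD HasT (fill G ((□ A) ∷ Γ ⇒ box (A ∷ Σ ⇒ Π) ∷ Δ))
      → Der HasD HasT (fill G ((□ A) ∷ Γ ⇒ box (Σ ⇒ Π) ∷ Δ))
  □R  : ∀ {G Γ Δ A} → Der HasD HasT (fill G (Γ ⇒ box ([] ⇒ fm A ∷ []) ∷ Δ))
      → Der HasD HasT (fill G (Γ ⇒ fm (□ A) ∷ Δ))
  ◇L  : ∀ {G Γ Δ A} → Der HasD HasT (fill G (Γ ⇒ box (A ∷ [] ⇒ []) ∷ Δ))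
      → Der HasD HasT (fill G ((◇ A) ∷ Γ ⇒ Δ))
  ◇R  : ∀ {G Γ Δ Σ Π A} → Der HasD HasT (fill G (Γ ⇒ fm (◇ A) ∷ box (Σ ⇒ fm A ∷ Π) ∷ Δ))
      → Der HasD HasT (fill G (Γ ⇒ fm (◇ A) ∷ box (Σ ⇒ Π) ∷ Δ))
  trans : ∀ {G Γ Γ' Δ Σ Π} → Der HasD HasT (fill G (Γ ++ Γ' ⇒ imp (Γ' ++ Σ ⇒ Π) ∷ Δ))
      → Der HasD HasT (fill G (Γ ++ Γ' ⇒ imp (Σ ⇒ Π) ∷ Δ))
  inter→ : ∀ {G Γ Δ Σ Π Λ Θ}
      → Der HasD HasT (fill G (Γ ⇒ imp (Σ ⇒ box (Λ ⇒ flat Θ) ∷ Π) ∷ box (Λ ⇒ Θ) ∷ Δ))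
      → Der HasD HasT (fill G (Γ ⇒ imp (Σ ⇒ Π) ∷ box (Λ ⇒ Θ) ∷ Δ))
  D   : ∀ {G Γ Δ} → HasD → Der HasD HasT (fill G (Γ ⇒ box ([] ⇒ []) ∷ Δ))
      → Der HasD HasT (fill G (Γ ⇒ Δ))
  T□  : ∀ {G Γ Δ A} → HasT → Der HasD HasT (fill G ((□ A) ∷ A ∷ Γ ⇒ Δ))
      → Der HasD HasT (fill G ((□ A) ∷ Γ ⇒ Δ))
  T◇  : ∀ {G Γ Δ A} → HasT → Der HasD HasT (fill G (Γ ⇒ fm (◇ A) ∷ fm A ∷ Δ))
      → Der HasD HasT (fill G (Γ ⇒ fm (◇ A) ∷ Δ))
  perm : ∀ {S S'} → S ≈S S' → Der HasD HasT S → Der HasD HasT S'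

module _ {HasD HasT HasD' HasT' : Set} (d : HasD → HasD') (t : HasT → HasT') where
  Der-map : ∀ {S} → Der HasD HasT S → Der HasD' HasT' S
  Der-map ax⊥ = ax⊥
  Der-map ax⊤ = ax⊤
  Der-map axp = axp
  Der-map (∧L p) = ∧L (Der-map p)
  Der-map (∧R p q) = ∧R (Der-map p) (Der-map q)
  Der-map (∨L p q) = ∨L (Der-map p) (Der-map q)
  Der-map (∨R p) = ∨R (Der-map p)
  Der-map (⊃L p q) = ⊃L (Der-map p) (Der-map q)
  Der-map (⊃R p) = ⊃R (Der-map p)
  Der-map (□L p) = □L (Der-map p)
  Der-map (□R p) = □R (Der-map p)
  Der-map (◇L p) = ◇L (Der-map p)
  Der-map (◇R p) = ◇R (Der-map p)
  Der-map (trans p) = trans (Der-map p)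
  Der-map (inter→ p) = inter→ (Der-map p)
  Der-map (D h p) = D (d h) (Der-map p)
  Der-map (T□ h p) = T□ (t h) (Der-map p)
  Der-map (T◇ h p) = T◇ (t h) (Der-map p)
  Der-map (perm e p) = perm e (Der-map p)

module _ {L : Logic} where
  Prov⇒Der : ∀ {S} → Prov L S → Der (L ≡ LIKD) (L ≡ LIKT) S
  Prov⇒Der ax⊥ = ax⊥
  Prov⇒Der ax⊤ = ax⊤
  Prov⇒Der axp = axp
  Prov⇒Der (∧L p) = ∧L (Prov⇒Der p)
  Prov⇒Der (∧R p q) = ∧R (Prov⇒Der p) (Prov⇒Der q)
  Prov⇒Der (∨L p q) = ∨L (Prov⇒Der p) (Prov⇒Der q)
  Prov⇒Der (∨R p) = ∨R (Prov⇒Der p)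
  Prov⇒Der (⊃L p q) = ⊃L (Prov⇒Der p) (Prov⇒Der q)
  Prov⇒Der (⊃R p) = ⊃R (Prov⇒Der p)
  Prov⇒Der (□L p) = □L (Prov⇒Der p)
  Prov⇒Der (□R p) = □R (Prov⇒Der p)
  Prov⇒Der (◇L p) = ◇L (Prov⇒Der p)
  Prov⇒Der (◇R p) = ◇R (Prov⇒Der p)
  Prov⇒Der (trans p) = trans (Prov⇒Der p)
  Prov⇒Der (inter→ p) = inter→ (Prov⇒Der p)
  Prov⇒Der (D h p) = D h (Prov⇒Der p)
  Prov⇒Der (T□ h p) = T□ h (Prov⇒Der p)
  Prov⇒Der (T◇ h p) = T◇ h (Prov⇒Der p)
  Prov⇒Der (perm e p) = perm e (Prov⇒Der p)

  Der⇒Prov : ∀ {S} → Der (L ≡ LIKD) (L ≡ LIKT) S → Prov L S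
  Der⇒Prov ax⊥ = ax⊥
  Der⇒Prov ax⊤ = ax⊤
  Der⇒Prov axp = axp
  Der⇒Prov (∧L p) = ∧L (Der⇒Prov p)
  Der⇒Prov (∧R p q) = ∧R (Der⇒Prov p) (Der⇒Prov q)
  Der⇒Prov (∨L p q) = ∨L (Der⇒Prov p) (Der⇒Prov q)
  Der⇒Prov (∨R p) = ∨R (Der⇒Prov p)
  Der⇒Prov (⊃L p q) = ⊃L (Der⇒Prov p) (Der⇒Prov q)
  Der⇒Prov (⊃R p) = ⊃R (Der⇒Prov p)
  Der⇒Prov (□L p) = □L (Der⇒Prov p)
  Der⇒Prov (□R p) = □R (Der⇒Prov p)
  Der⇒Prov (◇L p) = ◇L (Der⇒Prov p)
  Der⇒Prov (◇R p) = ◇R (Der⇒Prov p)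
  Der⇒Prov (trans p) = trans (Der⇒Prov p)
  Der⇒Prov (inter→ p) = inter→ (Der⇒Prov p)
  Der⇒Prov (D h p) = D h (Der⇒Prov p)
  Der⇒Prov (T□ h p) = T□ h (Der⇒Prov p)
  Der⇒Prov (T◇ h p) = T◇ h (Der⇒Prov p)
  Der⇒Prov (perm e p) = perm e (Der⇒Prov p)

mutual
  ≈S-refl : ∀ {S} → S ≈S S
  ≈S-refl {Γ ⇒ Δ} = seq≈ ↭-refl ≈L-refl

  ≈I-refl : ∀ {i} → i ≈I i
  ≈I-refl {fm A} = fm≈
  ≈I-refl {box S} = box≈ ≈S-refl
  ≈I-refl {imp S} = imp≈ ≈S-refl

  ≈L-refl : ∀ {xs} → xs ≈L xs
  ≈L-refl {[]} = nil≈
  ≈L-refl {x ∷ xs} = cons≈ ≈I-refl ≈L-refl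

mutual
  ≈S-sym : ∀ {S S'} → S ≈S S' → S' ≈S S
  ≈S-sym (seq≈ p q) = seq≈ (↭-sym p) (≈L-sym q)

  ≈I-sym : ∀ {i j} → i ≈I j → j ≈I i
  ≈I-sym fm≈ = fm≈
  ≈I-sym (box≈ p) = box≈ (≈S-sym p)
  ≈I-sym (imp≈ p) = imp≈ (≈S-sym p)

  ≈L-sym : ∀ {xs ys} → xs ≈L ys → ys ≈L xs
  ≈L-sym nil≈ = nil≈
  ≈L-sym (cons≈ p q) = cons≈ (≈I-sym p) (≈L-sym q)
  ≈L-sym swap≈ = swap≈
  ≈L-sym (trans≈ p q) = trans≈ (≈L-sym q) (≈L-sym p)

≈S-trans : ∀ {S S' S''} → S ≈S S' → S' ≈S S'' → S ≈S S''
≈S-trans (seq≈ p q) (seq≈ p' q') = seq≈ (↭-trans p p') (trans≈ q q')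

≡⇒≈L : ∀ {xs ys} → xs ≡ ys → xs ≈L ys
≡⇒≈L refl = ≈L-refl

++⁺ˡ-≈L : ∀ zs {xs ys} → xs ≈L ys → (zs ++ xs) ≈L (zs ++ ys)
++⁺ˡ-≈L [] h = h
++⁺ˡ-≈L (z ∷ zs) h = cons≈ ≈I-refl (++⁺ˡ-≈L zs h)

++⁺ʳ-≈L : ∀ {xs ys} zs → xs ≈L ys → (xs ++ zs) ≈L (ys ++ zs)
++⁺ʳ-≈L zs nil≈ = ≈L-refl
++⁺ʳ-≈L zs (cons≈ p q) = cons≈ p (++⁺ʳ-≈L zs q)
++⁺ʳ-≈L zs swap≈ = swap≈
++⁺ʳ-≈L zs (trans≈ p q) = trans≈ (++⁺ʳ-≈L zs p) (++⁺ʳ-≈L zs q)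

++⁺-≈L : ∀ {ws xs ys zs} → ws ≈L xs → ys ≈L zs → (ws ++ ys) ≈L (xs ++ zs)
++⁺-≈L {xs = xs} {ys} p q = trans≈ (++⁺ʳ-≈L ys p) (++⁺ˡ-≈L xs q)

shift-≈L : ∀ x ys zs → (x ∷ ys ++ zs) ≈L (ys ++ x ∷ zs)
shift-≈L x [] zs = ≈L-refl
shift-≈L x (y ∷ ys) zs = trans≈ swap≈ (cons≈ ≈I-refl (shift-≈L x ys zs))

shifts-≈L : ∀ xs ys zs → (xs ++ ys ++ zs) ≈L (ys ++ xs ++ zs)
shifts-≈L [] ys zs = ≈L-refl
shifts-≈L (x ∷ xs) ys zs = trans≈ (cons≈ ≈I-refl (shifts-≈L xs ys zs)) (shift-≈L x ys (xs ++ zs))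

++-comm-≈L : ∀ xs ys → (xs ++ ys) ≈L (ys ++ xs)
++-comm-≈L xs ys = trans≈ (≡⇒≈L (cong (xs ++_) (sym (++-identityʳ ys))))
  (trans≈ (shifts-≈L xs ys []) (≡⇒≈L (cong (ys ++_) (++-identityʳ xs))))

fill-≈ : ∀ G {S S'} → S ≈S S' → fill G S ≈S fill G S'
fill-≈ hole p = p
fill-≈ (inBox Γ Δ G) p = seq≈ ↭-refl (++⁺ˡ-≈L Δ (cons≈ (box≈ (fill-≈ G p)) nil≈))
fill-≈ (inImp Γ Δ G) p = seq≈ ↭-refl (++⁺ˡ-≈L Δ (cons≈ (imp≈ (fill-≈ G p)) nil≈))

module _ {HasD HasT : Set} where
  perm-fill : ∀ G {S S'} → S ≈S S' → Der HasD HasT (fill G S) → Der HasD HasT (fill G S')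
  perm-fill G e = perm (fill-≈ G e)

flat-++ : ∀ xs ys → flat (xs ++ ys) ≡ flat xs ++ flat ys
flat-++ [] ys = refl
flat-++ (fm A ∷ xs) ys = flat-++ xs ys
flat-++ (imp S ∷ xs) ys = flat-++ xs ys
flat-++ (box (Φ ⇒ Ψ) ∷ xs) ys = cong (box (Φ ⇒ flat Ψ) ∷_) (flat-++ xs ys)

-- Splitting a derivation between the two disjuncts

data Side : Set where
  left right : Side

_≟_ : (r s : Side) → Dec (r ≡ s)
left  ≟ left  = yes refl
right ≟ right = yes refl
left  ≟ right = no λ ()
right ≟ left  = no λ ()

keep : Side → Side → Item → List Item
keep left  left  i = i ∷ []
keep right right i = i ∷ []
keep left  right i = []
keep right left  i = []

keep-self : ∀ s i → keep s s i ≡ i ∷ []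
keep-self left  i = refl
keep-self right i = refl

keep-dropped : ∀ r s i j → r ≢ s → keep r s i ≡ keep r s j
keep-dropped left  left  i j r≢s = ⊥-elim (r≢s refl)
keep-dropped right right i j r≢s = ⊥-elim (r≢s refl)
keep-dropped left  right i j r≢s = refl
keep-dropped right left  i j r≢s = refl

data IsDisj : Fml → Set where
  disj : ∀ {A B} → IsDisj (A ∨ B)

-- A disjunction may be split: its left disjunct goes to the left side, its right disjunct to the right.
FmlLabel : Fml → Set
FmlLabel A = Side ⊎ IsDisj A

keepFml : Side → (A : Fml) → FmlLabel A → List Item
keepFml r     A       (inj₁ s)    = keep r s (fm A)
keepFml left  (A ∨ B) (inj₂ disj) = fm A ∷ []
keepFml right (A ∨ B) (inj₂ disj) = fm B ∷ []

leftSide : ∀ {A B} → FmlLabel (A ∨ B) → Side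
leftSide (inj₁ s)    = s
leftSide (inj₂ disj) = left

rightSide : ∀ {A B} → FmlLabel (A ∨ B) → Side
rightSide (inj₁ s)    = s
rightSide (inj₂ disj) = right

-- The spine antecedents are empty in every sequent above
-- ⇒ A ∨ B, and only such sequents are labelled; this is what makes left rules on the spine impossible.
mutual
  Label : Seq → Set
  Label ([] ⇒ Δ)    = LabelList Δ
  Label (_ ∷ _ ⇒ _) = ⊥

  LabelItem : Item → Set
  LabelItem (fm A)  = FmlLabel A
  LabelItem (box S) = Label S
  LabelItem (imp S) = Side

  LabelList : List Item → Set
  LabelList []      = ⊤
  LabelList (i ∷ Δ) = LabelItem i × LabelList Δ

mutual
  restrict : Side → (S : Seq) → Label S → Seq
  restrict r ([] ⇒ Δ) e = [] ⇒ restrictList r Δ e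
  restrict r (_ ∷ _ ⇒ Δ) ()

  restrictItem : Side → (i : Item) → LabelItem i → List Item
  restrictItem r (fm A)  a = keepFml r A a
  restrictItem r (box S) e = box (restrict r S e) ∷ []
  restrictItem r (imp S) s = keep r s (imp S)

  restrictList : Side → (Δ : List Item) → LabelList Δ → List Item
  restrictList r []      _       = []
  restrictList r (i ∷ Δ) (a , e) = restrictItem r i a ++ restrictList r Δ e

LabelList-++⁺ : ∀ {Δ Δ'} → LabelList Δ → LabelList Δ' → LabelList (Δ ++ Δ')
LabelList-++⁺ {[]}    _       e' = e'
LabelList-++⁺ {i ∷ Δ} (a , e) e' = a , LabelList-++⁺ e e'

LabelList-++⁻ : ∀ Δ {Δ'} (e : LabelList (Δ ++ Δ'))
              → Σ (LabelList Δ) λ d → Σ (LabelList Δ') λ d' → e ≡ LabelList-++⁺ d d'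
LabelList-++⁻ []      e = tt , e , refl
LabelList-++⁻ (i ∷ Δ) (a , e) with LabelList-++⁻ Δ e
... | d , d' , refl = (a , d) , d' , refl

restrictList-++ : ∀ r Δ {Δ'} (e : LabelList Δ) (e' : LabelList Δ')
                → restrictList r (Δ ++ Δ') (LabelList-++⁺ e e') ≡ restrictList r Δ e ++ restrictList r Δ' e'
restrictList-++ r []      e       e' = refl
restrictList-++ r (i ∷ Δ) (a , e) e' =
  ≡-trans (cong (restrictItem r i a ++_) (restrictList-++ r Δ e e')) (sym (++-assoc (restrictItem r i a) _ _))

data SpineCtx : Ctx → Set where
  hole  : SpineCtx hole
  inBox : ∀ {Δ G} → LabelList Δ → SpineCtx G → SpineCtx (inBox [] Δ G)

data ImpCtx : Ctx → Set where
  inBox : ∀ {Δ G} → LabelList Δ → ImpCtx G → ImpCtx (inBox [] Δ G)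
  inImp : ∀ {Δ G} → LabelList Δ → Side → ImpCtx (inImp [] Δ G)

fillSpine : ∀ {G Y} → SpineCtx G → Label Y → Label (fill G Y)
fillSpine hole        e = e
fillSpine (inBox d g) e = LabelList-++⁺ d (fillSpine g e , tt)

restrictSpine : ∀ {G} → Side → SpineCtx G → Ctx
restrictSpine r hole            = hole
restrictSpine r (inBox {Δ} d g) = inBox [] (restrictList r Δ d) (restrictSpine r g)

restrict-fillSpine : ∀ {G} r (g : SpineCtx G) Y (e : Label Y)
                   → restrict r (fill G Y) (fillSpine g e) ≡ fill (restrictSpine r g) (restrict r Y e)
restrict-fillSpine r hole Y e = refl
restrict-fillSpine r (inBox {Δ} d g) Y e =
  ≡-trans (cong ([] ⇒_) (restrictList-++ r Δ d (fillSpine g e , tt)))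
          (cong (λ S → [] ⇒ restrictList r Δ d ++ box S ∷ []) (restrict-fillSpine r g Y e))

restrict-fillSpine-cong : ∀ {G X Y} r (g : SpineCtx G) (eX : Label X) (eY : Label Y)
                        → restrict r X eX ≡ restrict r Y eY
                        → restrict r (fill G X) (fillSpine g eX) ≡ restrict r (fill G Y) (fillSpine g eY)
restrict-fillSpine-cong {X = X} {Y} r g eX eY X≡Y =
  ≡-trans (restrict-fillSpine r g X eX) (≡-trans (cong (fill (restrictSpine r g)) X≡Y) (sym (restrict-fillSpine r g Y eY)))

fillImp : ∀ {G} → ImpCtx G → (Y : Seq) → Label (fill G Y)
fillImp (inBox d g) Y = LabelList-++⁺ d (fillImp g Y , tt)
fillImp (inImp d s) Y = LabelList-++⁺ d (s , tt)

impSide : ∀ {G} → ImpCtx G → Side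
impSide (inBox d g) = impSide g
impSide (inImp d s) = s

restrictImp : ∀ {G} → ImpCtx G → Ctx
restrictImp (inBox {Δ} d g)   = inBox [] (restrictList (impSide g) Δ d) (restrictImp g)
restrictImp (inImp {Δ} {G} d s) = inImp [] (restrictList s Δ d) G

restrict-fillImp-kept : ∀ {G} (g : ImpCtx G) Y
                      → restrict (impSide g) (fill G Y) (fillImp g Y) ≡ fill (restrictImp g) Y
restrict-fillImp-kept (inBox {Δ} d g) Y =
  ≡-trans (cong ([] ⇒_) (restrictList-++ (impSide g) Δ d (fillImp g Y , tt)))
          (cong (λ S → [] ⇒ restrictList (impSide g) Δ d ++ box S ∷ []) (restrict-fillImp-kept g Y))
restrict-fillImp-kept (inImp {Δ} {G} d s) Y =
  ≡-trans (cong ([] ⇒_) (restrictList-++ s Δ d (s , tt)))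
          (cong (λ Θ → [] ⇒ restrictList s Δ d ++ Θ) (≡-trans (++-identityʳ _) (keep-self s (imp (fill G Y)))))

restrict-fillImp-dropped : ∀ {G} r (g : ImpCtx G) Y Z → r ≢ impSide g
                         → restrict r (fill G Y) (fillImp g Y) ≡ restrict r (fill G Z) (fillImp g Z)
restrict-fillImp-dropped r (inBox {Δ} d g) Y Z r≢s =
  ≡-trans (cong ([] ⇒_) (restrictList-++ r Δ d (fillImp g Y , tt)))
    (≡-trans (cong (λ S → [] ⇒ restrictList r Δ d ++ box S ∷ []) (restrict-fillImp-dropped r g Y Z r≢s))
             (sym (cong ([] ⇒_) (restrictList-++ r Δ d (fillImp g Z , tt)))))
restrict-fillImp-dropped r (inImp {Δ} d s) Y Z r≢s =
  ≡-trans (cong ([] ⇒_) (restrictList-++ r Δ d (s , tt)))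
    (≡-trans (cong (λ Θ → [] ⇒ restrictList r Δ d ++ Θ ++ []) (keep-dropped r s _ _ r≢s))
             (sym (cong ([] ⇒_) (restrictList-++ r Δ d (s , tt)))))

Label-fill⁻ : ∀ G X (e : Label (fill G X))
            → (Σ (SpineCtx G) λ g → Σ (Label X) λ eX → e ≡ fillSpine g eX)
            ⊎ (Σ (ImpCtx G) λ g → e ≡ fillImp g X)
Label-fill⁻ hole X e = inj₁ (hole , e , refl)
Label-fill⁻ (inBox [] Δ G) X e with LabelList-++⁻ Δ e
... | d , (e₁ , tt) , refl with Label-fill⁻ G X e₁
...   | inj₁ (g , eX , refl) = inj₁ (inBox d g , eX , refl)
...   | inj₂ (g , refl)      = inj₂ (inBox d g , refl)
Label-fill⁻ (inBox (_ ∷ _) Δ G) X ()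
Label-fill⁻ (inImp [] Δ G) X e with LabelList-++⁻ Δ e
... | d , (s , tt) , refl = inj₂ (inImp d s , refl)
Label-fill⁻ (inImp (_ ∷ _) Δ G) X ()

keep-imp-≈ : ∀ r s {S S'} → S ≈S S' → keep r s (imp S) ≈L keep r s (imp S')
keep-imp-≈ left  left  p = cons≈ (imp≈ p) nil≈
keep-imp-≈ right right p = cons≈ (imp≈ p) nil≈
keep-imp-≈ left  right p = nil≈
keep-imp-≈ right left  p = nil≈

mutual
  restrict-≈ : ∀ {S S'} → S ≈S S' → (e' : Label S')
             → Σ (Label S) λ e → ∀ r → restrict r S e ≈S restrict r S' e'
  restrict-≈ (seq≈ {Γ' = _ ∷ _} p q) ()
  restrict-≈ (seq≈ {Γ' = []} p q) e' with ↭-empty-inv p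
  ... | refl with restrictList-≈ q e'
  ...   | e , h = e , λ r → seq≈ ↭-refl (h r)

  restrictItem-≈ : ∀ {i j} → i ≈I j → (a' : LabelItem j)
                 → Σ (LabelItem i) λ a → ∀ r → restrictItem r i a ≈L restrictItem r j a'
  restrictItem-≈ fm≈ a' = a' , λ r → ≈L-refl
  restrictItem-≈ (box≈ p) e' with restrict-≈ p e'
  ... | e , h = e , λ r → cons≈ (box≈ (h r)) nil≈
  restrictItem-≈ (imp≈ p) s = s , λ r → keep-imp-≈ r s p

  restrictList-≈ : ∀ {Δ Δ'} → Δ ≈L Δ' → (e' : LabelList Δ')
                 → Σ (LabelList Δ) λ e → ∀ r → restrictList r Δ e ≈L restrictList r Δ' e'
  restrictList-≈ nil≈ e' = tt , λ r → nil≈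
  restrictList-≈ (cons≈ p q) (a' , e') with restrictItem-≈ p a' | restrictList-≈ q e'
  ... | a , h₁ | e , h₂ = (a , e) , λ r → ++⁺-≈L (h₁ r) (h₂ r)
  restrictList-≈ (swap≈ {x} {y} {xs}) (b , a , e) =
    (a , b , e) , λ r → shifts-≈L (restrictItem r x a) (restrictItem r y b) (restrictList r xs e)
  restrictList-≈ (trans≈ p q) e'' with restrictList-≈ q e''
  ... | e' , h₁ with restrictList-≈ p e'
  ...   | e , h₀ = e , λ r → trans≈ (h₀ r) (h₁ r)

flat-keep : ∀ r s i → flat (i ∷ []) ≡ [] → flat (keep r s i) ≡ []
flat-keep left  left  i h = h
flat-keep right right i h = h
flat-keep left  right i h = refl
flat-keep right left  i h = refl

flat-keepFml : ∀ r A (a : FmlLabel A) → flat (keepFml r A a) ≡ []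
flat-keepFml r     A       (inj₁ s)    = flat-keep r s (fm A) refl
flat-keepFml left  (A ∨ B) (inj₂ disj) = refl
flat-keepFml right (A ∨ B) (inj₂ disj) = refl

flat-restrictList : ∀ r Θ (e : LabelList Θ) → flat (restrictList r Θ e) ≡ flat Θ
flat-restrictList r [] e = refl
flat-restrictList r (fm A ∷ Θ) (a , e) =
  ≡-trans (flat-++ (keepFml r A a) _) (cong₂ _++_ (flat-keepFml r A a) (flat-restrictList r Θ e))
flat-restrictList r (imp S ∷ Θ) (s , e) =
  ≡-trans (flat-++ (keep r s (imp S)) _) (cong₂ _++_ (flat-keep r s (imp S) refl) (flat-restrictList r Θ e))
flat-restrictList r (box ([] ⇒ Ψ) ∷ Θ) (e₁ , e) =
  cong₂ (λ Ψ' Θ' → box ([] ⇒ Ψ') ∷ Θ') (flat-restrictList r Ψ e₁) (flat-restrictList r Θ e)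

module _ {HasT : Set} where
  private
    Der⁺ : Seq → Set
    Der⁺ = Der ⊤ HasT

  OneSide : (S : Seq) → Label S → Set
  OneSide S e = ∃ λ r → Der⁺ (restrict r S e)

  imp-axiom : ∀ {G X} (g : ImpCtx G) → Der⁺ (fill (restrictImp g) X) → OneSide (fill G X) (fillImp g X)
  imp-axiom {X = X} g p = impSide g , subst Der⁺ (sym (restrict-fillImp-kept g X)) p

  imp-rule₁ : ∀ {G X Y} (g : ImpCtx G)
            → (Der⁺ (fill (restrictImp g) Y) → Der⁺ (fill (restrictImp g) X))
            → OneSide (fill G Y) (fillImp g Y) → OneSide (fill G X) (fillImp g X)
  imp-rule₁ {X = X} {Y} g rule (r , p) with r ≟ impSide g
  ... | yes refl = imp-axiom g (rule (subst Der⁺ (restrict-fillImp-kept g Y) p))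
  ... | no r≢s   = r , subst Der⁺ (restrict-fillImp-dropped r g Y X r≢s) p

  imp-rule₂ : ∀ {G X Y Z} (g : ImpCtx G)
            → (Der⁺ (fill (restrictImp g) Y) → Der⁺ (fill (restrictImp g) Z) → Der⁺ (fill (restrictImp g) X))
            → OneSide (fill G Y) (fillImp g Y) → OneSide (fill G Z) (fillImp g Z) → OneSide (fill G X) (fillImp g X)
  imp-rule₂ {X = X} {Y} {Z} g rule (r , p) (r' , q) with r ≟ impSide g | r' ≟ impSide g
  ... | no r≢s    | _         = r , subst Der⁺ (restrict-fillImp-dropped r g Y X r≢s) p
  ... | yes _     | no r'≢s   = r' , subst Der⁺ (restrict-fillImp-dropped r' g Z X r'≢s) q
  ... | yes refl  | yes refl  =
    imp-axiom g (rule (subst Der⁺ (restrict-fillImp-kept g Y) p) (subst Der⁺ (restrict-fillImp-kept g Z) q))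

  spine-axiom : ∀ {G X} (g : SpineCtx G) (eX : Label X) r
              → (∀ {H} → Der⁺ (fill H (restrict r X eX))) → OneSide (fill G X) (fillSpine g eX)
  spine-axiom {X = X} g eX r ax = r , subst Der⁺ (sym (restrict-fillSpine r g X eX)) ax

  spine-rule₁ : ∀ {G X Y} (g : SpineCtx G) (eX : Label X) (eY : Label Y)
              → (∀ r {H} → Der⁺ (fill H (restrict r Y eY)) → Der⁺ (fill H (restrict r X eX)))
              → OneSide (fill G Y) (fillSpine g eY) → OneSide (fill G X) (fillSpine g eX)
  spine-rule₁ {X = X} {Y} g eX eY rule (r , p) =
    r , subst Der⁺ (sym (restrict-fillSpine r g X eX)) (rule r (subst Der⁺ (restrict-fillSpine r g Y eY) p))

  spine-rule₂ : ∀ {G X Y Z} (g : SpineCtx G) (eX : Label X) (eY : Label Y) (eZ : Label Z) s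
              → (∀ {H} → Der⁺ (fill H (restrict s Y eY)) → Der⁺ (fill H (restrict s Z eZ))
                       → Der⁺ (fill H (restrict s X eX)))
              → (∀ r → r ≢ s → restrict r Y eY ≡ restrict r X eX)
              → (∀ r → r ≢ s → restrict r Z eZ ≡ restrict r X eX)
              → OneSide (fill G Y) (fillSpine g eY) → OneSide (fill G Z) (fillSpine g eZ)
              → OneSide (fill G X) (fillSpine g eX)
  spine-rule₂ {X = X} {Y} {Z} g eX eY eZ s rule Y≡X Z≡X (r , p) (r' , q) with r ≟ s | r' ≟ s
  ... | no r≢s   | _        = r , subst Der⁺ (restrict-fillSpine-cong r g eY eX (Y≡X r r≢s)) p
  ... | yes _    | no r'≢s  = r' , subst Der⁺ (restrict-fillSpine-cong r' g eZ eX (Z≡X r' r'≢s)) q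
  ... | yes refl | yes refl = s , subst Der⁺ (sym (restrict-fillSpine s g X eX))
      (rule (subst Der⁺ (restrict-fillSpine s g Y eY) p) (subst Der⁺ (restrict-fillSpine s g Z eZ) q))

  restricted-ax⊤ : ∀ s Θ {H} → Der⁺ (fill H ([] ⇒ keep s s (fm top) ++ Θ))
  restricted-ax⊤ left  Θ {H} = ax⊤ {G = H}
  restricted-ax⊤ right Θ {H} = ax⊤ {G = H}

  restricted-∧R : ∀ s A B Θ {H} → Der⁺ (fill H ([] ⇒ keep s s (fm A) ++ Θ)) → Der⁺ (fill H ([] ⇒ keep s s (fm B) ++ Θ))
                → Der⁺ (fill H ([] ⇒ keep s s (fm (A ∧ B)) ++ Θ))
  restricted-∧R left  A B Θ {H} = ∧R {G = H}
  restricted-∧R right A B Θ {H} = ∧R {G = H}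

  restricted-∨R : ∀ r A B (a : FmlLabel (A ∨ B)) Θ {H}
                → Der⁺ (fill H ([] ⇒ keep r (leftSide a) (fm A) ++ keep r (rightSide a) (fm B) ++ Θ))
                → Der⁺ (fill H ([] ⇒ keepFml r (A ∨ B) a ++ Θ))
  restricted-∨R left  A B (inj₁ left)  Θ {H} = ∨R {G = H}
  restricted-∨R right A B (inj₁ right) Θ {H} = ∨R {G = H}
  restricted-∨R left  A B (inj₁ right) Θ p = p
  restricted-∨R right A B (inj₁ left)  Θ p = p
  restricted-∨R left  A B (inj₂ disj)  Θ p = p
  restricted-∨R right A B (inj₂ disj)  Θ p = p

  restricted-⊃R : ∀ r s A B Θ {H} → Der⁺ (fill H ([] ⇒ keep r s (imp (A ∷ [] ⇒ fm B ∷ [])) ++ Θ))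
                → Der⁺ (fill H ([] ⇒ keep r s (fm (A ⊃ B)) ++ Θ))
  restricted-⊃R left  left  A B Θ {H} = ⊃R {G = H}
  restricted-⊃R right right A B Θ {H} = ⊃R {G = H}
  restricted-⊃R left  right A B Θ p = p
  restricted-⊃R right left  A B Θ p = p

  -- Dropping □ A leaves the empty block [⇒]: the one place where (D) is needed.
  restricted-□R : ∀ r s A Θ {H} → Der⁺ (fill H ([] ⇒ box ([] ⇒ keep r s (fm A) ++ []) ∷ Θ))
                → Der⁺ (fill H ([] ⇒ keep r s (fm (□ A)) ++ Θ))
  restricted-□R left  left  A Θ {H} = □R {G = H}
  restricted-□R right right A Θ {H} = □R {G = H}
  restricted-□R left  right A Θ {H} = D {G = H} tt
  restricted-□R right left  A Θ {H} = D {G = H} tt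

  restricted-◇R : ∀ r s A Π Θ {H} → Der⁺ (fill H ([] ⇒ keep r s (fm (◇ A)) ++ box ([] ⇒ keep r s (fm A) ++ Π) ∷ Θ))
                → Der⁺ (fill H ([] ⇒ keep r s (fm (◇ A)) ++ box ([] ⇒ Π) ∷ Θ))
  restricted-◇R left  left  A Π Θ {H} = ◇R {G = H}
  restricted-◇R right right A Π Θ {H} = ◇R {G = H}
  restricted-◇R left  right A Π Θ p = p
  restricted-◇R right left  A Π Θ p = p

  restricted-T◇ : ∀ r s A Θ {H} → HasT → Der⁺ (fill H ([] ⇒ keep r s (fm (◇ A)) ++ keep r s (fm A) ++ Θ))
                → Der⁺ (fill H ([] ⇒ keep r s (fm (◇ A)) ++ Θ))
  restricted-T◇ left  left  A Θ {H} t = T◇ {G = H} t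
  restricted-T◇ right right A Θ {H} t = T◇ {G = H} t
  restricted-T◇ left  right A Θ t p = p
  restricted-T◇ right left  A Θ t p = p

  inter→-restrictList : ∀ r Σ Π Θ (e : LabelList Θ) Ξ {H}
                      → Der⁺ (fill H ([] ⇒ imp (Σ ⇒ box ([] ⇒ flat Θ) ∷ Π) ∷ box ([] ⇒ restrictList r Θ e) ∷ Ξ))
                      → Der⁺ (fill H ([] ⇒ imp (Σ ⇒ Π) ∷ box ([] ⇒ restrictList r Θ e) ∷ Ξ))
  inter→-restrictList r Σ Π Θ e Ξ {H} p = inter→ {G = H}
    (subst (λ Ψ → Der⁺ (fill H ([] ⇒ imp (Σ ⇒ box ([] ⇒ Ψ) ∷ Π) ∷ box ([] ⇒ restrictList r Θ e) ∷ Ξ)))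
           (sym (flat-restrictList r Θ e)) p)

  restricted-inter→ : ∀ r s Σ Π Θ (e : LabelList Θ) Ξ {H}
                    → Der⁺ (fill H ([] ⇒ keep r s (imp (Σ ⇒ box ([] ⇒ flat Θ) ∷ Π)) ++ box ([] ⇒ restrictList r Θ e) ∷ Ξ))
                    → Der⁺ (fill H ([] ⇒ keep r s (imp (Σ ⇒ Π)) ++ box ([] ⇒ restrictList r Θ e) ∷ Ξ))
  restricted-inter→ left  left  = inter→-restrictList left
  restricted-inter→ right right = inter→-restrictList right
  restricted-inter→ left  right Σ Π Θ e Ξ p = p
  restricted-inter→ right left  Σ Π Θ e Ξ p = p

restriction : ∀ {HasD HasT S} → Der HasD HasT S → (e : Label S) → OneSide {HasT} S e
restriction (ax⊥ {G} {Γ} {Δ}) e with Label-fill⁻ G (bot ∷ Γ ⇒ Δ) e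
... | inj₁ (g , () , refl)
... | inj₂ (g , refl) = imp-axiom g (ax⊥ {G = restrictImp g})
restriction (axp {G} {Γ} {Δ} {p}) e with Label-fill⁻ G (atom p ∷ Γ ⇒ fm (atom p) ∷ Δ) e
... | inj₁ (g , () , refl)
... | inj₂ (g , refl) = imp-axiom g (axp {G = restrictImp g})
restriction (ax⊤ {G} {Γ} {Δ}) e with Label-fill⁻ G (Γ ⇒ fm top ∷ Δ) e
... | inj₂ (g , refl) = imp-axiom g (ax⊤ {G = restrictImp g})
restriction (ax⊤ {G} {[]} {Δ}) e | inj₁ (g , (inj₁ s , d) , refl) =
  spine-axiom g (inj₁ s , d) s (restricted-ax⊤ s (restrictList s Δ d))
restriction (ax⊤ {G} {[]} {Δ}) e | inj₁ (g , (inj₂ () , d) , refl)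
restriction (ax⊤ {G} {_ ∷ _} {Δ}) e | inj₁ (g , () , refl)
restriction (∧L {G} {Γ} {Δ} {A} {B} p) e with Label-fill⁻ G (A ∧ B ∷ Γ ⇒ Δ) e
... | inj₁ (g , () , refl)
... | inj₂ (g , refl) = imp-rule₁ g (∧L {G = restrictImp g}) (restriction p (fillImp g _))
restriction (∨L {G} {Γ} {Δ} {A} {B} p q) e with Label-fill⁻ G (A ∨ B ∷ Γ ⇒ Δ) e
... | inj₁ (g , () , refl)
... | inj₂ (g , refl) = imp-rule₂ g (∨L {G = restrictImp g}) (restriction p (fillImp g _)) (restriction q (fillImp g _))
restriction (⊃L {G} {Γ} {Δ} {A} {B} p q) e with Label-fill⁻ G ((A ⊃ B) ∷ Γ ⇒ Δ) e
... | inj₁ (g , () , refl)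
... | inj₂ (g , refl) = imp-rule₂ g (⊃L {G = restrictImp g}) (restriction p (fillImp g _)) (restriction q (fillImp g _))
restriction (□L {G} {Γ} {Δ} {Σ} {Π} {A} p) e with Label-fill⁻ G ((□ A) ∷ Γ ⇒ box (Σ ⇒ Π) ∷ Δ) e
... | inj₁ (g , () , refl)
... | inj₂ (g , refl) = imp-rule₁ g (□L {G = restrictImp g}) (restriction p (fillImp g _))
restriction (◇L {G} {Γ} {Δ} {A} p) e with Label-fill⁻ G ((◇ A) ∷ Γ ⇒ Δ) e
... | inj₁ (g , () , refl)
... | inj₂ (g , refl) = imp-rule₁ g (◇L {G = restrictImp g}) (restriction p (fillImp g _))
restriction (T□ {G} {Γ} {Δ} {A} t p) e with Label-fill⁻ G ((□ A) ∷ Γ ⇒ Δ) e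
... | inj₁ (g , () , refl)
... | inj₂ (g , refl) = imp-rule₁ g (T□ {G = restrictImp g} t) (restriction p (fillImp g _))
restriction (∧R {G} {Γ} {Δ} {A} {B} p q) e with Label-fill⁻ G (Γ ⇒ fm (A ∧ B) ∷ Δ) e
... | inj₂ (g , refl) = imp-rule₂ g (∧R {G = restrictImp g}) (restriction p (fillImp g _)) (restriction q (fillImp g _))
restriction (∧R {G} {[]} {Δ} {A} {B} p q) e | inj₁ (g , (inj₁ s , d) , refl) =
  spine-rule₂ g (inj₁ s , d) (inj₁ s , d) (inj₁ s , d) s (restricted-∧R s A B (restrictList s Δ d))
    (λ r r≢s → cong (λ Θ → [] ⇒ Θ ++ restrictList r Δ d) (keep-dropped r s _ _ r≢s))
    (λ r r≢s → cong (λ Θ → [] ⇒ Θ ++ restrictList r Δ d) (keep-dropped r s _ _ r≢s))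
    (restriction p (fillSpine g _)) (restriction q (fillSpine g _))
restriction (∧R {G} {[]} {Δ} {A} {B} p q) e | inj₁ (g , (inj₂ () , d) , refl)
restriction (∧R {G} {_ ∷ _} {Δ} {A} {B} p q) e | inj₁ (g , () , refl)
restriction (∨R {G} {Γ} {Δ} {A} {B} p) e with Label-fill⁻ G (Γ ⇒ fm (A ∨ B) ∷ Δ) e
... | inj₂ (g , refl) = imp-rule₁ g (∨R {G = restrictImp g}) (restriction p (fillImp g _))
restriction (∨R {G} {[]} {Δ} {A} {B} p) e | inj₁ (g , (a , d) , refl) =
  spine-rule₁ g (a , d) (inj₁ (leftSide {A} {B} a) , inj₁ (rightSide {A} {B} a) , d)
    (λ r → restricted-∨R r A B a (restrictList r Δ d)) (restriction p (fillSpine g _))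
restriction (∨R {G} {_ ∷ _} {Δ} {A} {B} p) e | inj₁ (g , () , refl)
restriction (⊃R {G} {Γ} {Δ} {A} {B} p) e with Label-fill⁻ G (Γ ⇒ fm (A ⊃ B) ∷ Δ) e
... | inj₂ (g , refl) = imp-rule₁ g (⊃R {G = restrictImp g}) (restriction p (fillImp g _))
restriction (⊃R {G} {[]} {Δ} {A} {B} p) e | inj₁ (g , (inj₁ s , d) , refl) =
  spine-rule₁ g (inj₁ s , d) (s , d) (λ r → restricted-⊃R r s A B (restrictList r Δ d)) (restriction p (fillSpine g _))
restriction (⊃R {G} {[]} {Δ} {A} {B} p) e | inj₁ (g , (inj₂ () , d) , refl)
restriction (⊃R {G} {_ ∷ _} {Δ} {A} {B} p) e | inj₁ (g , () , refl)
restriction (□R {G} {Γ} {Δ} {A} p) e with Label-fill⁻ G (Γ ⇒ fm (□ A) ∷ Δ) e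
... | inj₂ (g , refl) = imp-rule₁ g (□R {G = restrictImp g}) (restriction p (fillImp g _))
restriction (□R {G} {[]} {Δ} {A} p) e | inj₁ (g , (inj₁ s , d) , refl) =
  spine-rule₁ g (inj₁ s , d) ((inj₁ s , tt) , d) (λ r → restricted-□R r s A (restrictList r Δ d))
    (restriction p (fillSpine g _))
restriction (□R {G} {[]} {Δ} {A} p) e | inj₁ (g , (inj₂ () , d) , refl)
restriction (□R {G} {_ ∷ _} {Δ} {A} p) e | inj₁ (g , () , refl)
restriction (◇R {G} {Γ} {Δ} {Σ} {Π} {A} p) e with Label-fill⁻ G (Γ ⇒ fm (◇ A) ∷ box (Σ ⇒ Π) ∷ Δ) e
... | inj₂ (g , refl) = imp-rule₁ g (◇R {G = restrictImp g}) (restriction p (fillImp g _))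
restriction (◇R {G} {[]} {Δ} {[]} {Π} {A} p) e | inj₁ (g , (inj₁ s , e₁ , d) , refl) =
  spine-rule₁ g (inj₁ s , e₁ , d) (inj₁ s , (inj₁ s , e₁) , d)
    (λ r → restricted-◇R r s A (restrictList r Π e₁) (restrictList r Δ d)) (restriction p (fillSpine g _))
restriction (◇R {G} {[]} {Δ} {[]} {Π} {A} p) e | inj₁ (g , (inj₂ () , e₁ , d) , refl)
restriction (◇R {G} {[]} {Δ} {_ ∷ _} {Π} {A} p) e | inj₁ (g , (a , () , d) , refl)
restriction (◇R {G} {_ ∷ _} {Δ} {Σ} {Π} {A} p) e | inj₁ (g , () , refl)
restriction (T◇ {G} {Γ} {Δ} {A} t p) e with Label-fill⁻ G (Γ ⇒ fm (◇ A) ∷ Δ) e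
... | inj₂ (g , refl) = imp-rule₁ g (T◇ {G = restrictImp g} t) (restriction p (fillImp g _))
restriction (T◇ {G} {[]} {Δ} {A} t p) e | inj₁ (g , (inj₁ s , d) , refl) =
  spine-rule₁ g (inj₁ s , d) (inj₁ s , inj₁ s , d) (λ r → restricted-T◇ r s A (restrictList r Δ d) t)
    (restriction p (fillSpine g _))
restriction (T◇ {G} {[]} {Δ} {A} t p) e | inj₁ (g , (inj₂ () , d) , refl)
restriction (T◇ {G} {_ ∷ _} {Δ} {A} t p) e | inj₁ (g , () , refl)
restriction (trans {G} {Γ} {Γ'} {Δ} {Σ} {Π} p) e with Label-fill⁻ G (Γ ++ Γ' ⇒ imp (Σ ⇒ Π) ∷ Δ) e
... | inj₂ (g , refl) = imp-rule₁ g (trans {G = restrictImp g}) (restriction p (fillImp g _))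
restriction (trans {G} {[]} {[]} {Δ} {Σ} {Π} p) e | inj₁ (g , eX , refl) = restriction p e
restriction (trans {G} {[]} {_ ∷ _} {Δ} {Σ} {Π} p) e | inj₁ (g , () , refl)
restriction (trans {G} {_ ∷ _} {Γ'} {Δ} {Σ} {Π} p) e | inj₁ (g , () , refl)
restriction (inter→ {G} {Γ} {Δ} {Σ} {Π} {Λ} {Θ} p) e with Label-fill⁻ G (Γ ⇒ imp (Σ ⇒ Π) ∷ box (Λ ⇒ Θ) ∷ Δ) e
... | inj₂ (g , refl) = imp-rule₁ g (inter→ {G = restrictImp g}) (restriction p (fillImp g _))
restriction (inter→ {G} {[]} {Δ} {Σ} {Π} {[]} {Θ} p) e | inj₁ (g , (s , e₁ , d) , refl) =
  spine-rule₁ g (s , e₁ , d) (s , e₁ , d) (λ r → restricted-inter→ r s Σ Π Θ e₁ (restrictList r Δ d))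
    (restriction p (fillSpine g _))
restriction (inter→ {G} {[]} {Δ} {Σ} {Π} {_ ∷ _} {Θ} p) e | inj₁ (g , (s , () , d) , refl)
restriction (inter→ {G} {_ ∷ _} {Δ} {Σ} {Π} {Λ} {Θ} p) e | inj₁ (g , () , refl)
restriction (D {G} {Γ} {Δ} _ p) e with Label-fill⁻ G (Γ ⇒ Δ) e
... | inj₂ (g , refl) = imp-rule₁ g (D {G = restrictImp g} tt) (restriction p (fillImp g _))
restriction (D {G} {[]} {Δ} _ p) e | inj₁ (g , d , refl) =
  spine-rule₁ g d (tt , d) (λ r {H} → D {G = H} tt) (restriction p (fillSpine g _))
restriction (D {G} {_ ∷ _} {Δ} _ p) e | inj₁ (g , () , refl)
restriction (perm S≈S' p) e' with restrict-≈ S≈S' e'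
... | e , restrict≈ with restriction p e
...   | r , q = r , perm (restrict≈ r) q

-- Merging modal blocks into their parents under T

antecedent : Seq → List Fml
antecedent (Γ ⇒ Δ) = Γ

succedent : Seq → List Item
succedent (Γ ⇒ Δ) = Δ

extend : Seq → List Fml → List Item → Seq
extend S Γ Δ = antecedent S ++ Γ ⇒ succedent S ++ Δ

merge : List Fml → List Item → Seq → Seq
merge Γ Δ S = Γ ++ antecedent S ⇒ Δ ++ succedent S

extend-[] : ∀ S → S ≈S extend S [] []
extend-[] (Γ ⇒ Δ) = seq≈ (↭-reflexive (sym (++-identityʳ Γ))) (≡⇒≈L (sym (++-identityʳ Δ)))

antecedent-≈ : ∀ {S S'} → S ≈S S' → antecedent S ↭ antecedent S'
antecedent-≈ (seq≈ p q) = p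

succedent-≈ : ∀ {S S'} → S ≈S S' → succedent S ≈L succedent S'
succedent-≈ (seq≈ p q) = q

merge-≈ : ∀ Γ Δ {S S'} → S ≈S S' → merge Γ Δ S ≈S merge Γ Δ S'
merge-≈ Γ Δ (seq≈ p q) = seq≈ (++⁺ˡ Γ p) (++⁺ˡ-≈L Δ q)

merge-fill : ∀ Γ Δ G Γ₁ Δ₁ → Σ Ctx λ G' → Σ (List Fml) λ Γ₂ → Σ (List Item) λ Δ₂ →
             ∀ W → merge Γ Δ (fill G (extend W Γ₁ Δ₁)) ≈S fill G' (extend W Γ₂ Δ₂)
merge-fill Γ Δ hole Γ₁ Δ₁ = hole , Γ₁ ++ Γ , Δ₁ ++ Δ , λ W →
  seq≈ (↭-trans (++-comm Γ _) (↭-reflexive (++-assoc (antecedent W) Γ₁ Γ)))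
       (trans≈ (++-comm-≈L Δ _) (≡⇒≈L (++-assoc (succedent W) Δ₁ Δ)))
merge-fill Γ Δ (inBox Γ' Δ' G) Γ₁ Δ₁ = inBox (Γ ++ Γ') (Δ ++ Δ') G , Γ₁ , Δ₁ , λ W →
  seq≈ ↭-refl (≡⇒≈L (sym (++-assoc Δ Δ' _)))
merge-fill Γ Δ (inImp Γ' Δ' G) Γ₁ Δ₁ = inImp (Γ ++ Γ') (Δ ++ Δ') G , Γ₁ , Δ₁ , λ W →
  seq≈ ↭-refl (≡⇒≈L (sym (++-assoc Δ Δ' _)))

-- A mark on a modal block says whether the block is merged into its parent.
mutual
  Marks : Seq → Set
  Marks (Γ ⇒ Δ) = MarksList Δ

  MarksItem : Item → Set
  MarksItem (fm A)  = ⊤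
  MarksItem (box S) = Bool × Marks S
  MarksItem (imp S) = Marks S

  MarksList : List Item → Set
  MarksList []      = ⊤
  MarksList (i ∷ Δ) = MarksItem i × MarksList Δ

mutual
  collapse : (S : Seq) → Marks S → Seq
  collapse (Γ ⇒ Δ) m = Γ ++ collapseAnt Δ m ⇒ collapseSuc Δ m

  collapseItemAnt : (i : Item) → MarksItem i → List Fml
  collapseItemAnt (fm A)  _           = []
  collapseItemAnt (box S) (false , m) = []
  collapseItemAnt (box S) (true , m)  = antecedent (collapse S m)
  collapseItemAnt (imp S) m           = []

  collapseItemSuc : (i : Item) → MarksItem i → List Item
  collapseItemSuc (fm A)  _           = fm A ∷ []
  collapseItemSuc (box S) (false , m) = box (collapse S m) ∷ []
  collapseItemSuc (box S) (true , m)  = succedent (collapse S m)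
  collapseItemSuc (imp S) m           = imp (collapse S m) ∷ []

  collapseAnt : (Δ : List Item) → MarksList Δ → List Fml
  collapseAnt []      _       = []
  collapseAnt (i ∷ Δ) (b , m) = collapseItemAnt i b ++ collapseAnt Δ m

  collapseSuc : (Δ : List Item) → MarksList Δ → List Item
  collapseSuc []      _       = []
  collapseSuc (i ∷ Δ) (b , m) = collapseItemSuc i b ++ collapseSuc Δ m

mutual
  noMarks : ∀ S → Marks S
  noMarks (Γ ⇒ Δ) = noMarksList Δ

  noMarksItem : ∀ i → MarksItem i
  noMarksItem (fm A)  = tt
  noMarksItem (box S) = false , noMarks S
  noMarksItem (imp S) = noMarks S

  noMarksList : ∀ Δ → MarksList Δ
  noMarksList []      = tt
  noMarksList (i ∷ Δ) = noMarksItem i , noMarksList Δ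

collapseAnt-noMarks : ∀ Δ → collapseAnt Δ (noMarksList Δ) ≡ []
collapseAnt-noMarks []          = refl
collapseAnt-noMarks (fm A ∷ Δ)  = collapseAnt-noMarks Δ
collapseAnt-noMarks (box S ∷ Δ) = collapseAnt-noMarks Δ
collapseAnt-noMarks (imp S ∷ Δ) = collapseAnt-noMarks Δ

mutual
  collapse-noMarks : ∀ S → collapse S (noMarks S) ≈S S
  collapse-noMarks (Γ ⇒ Δ) =
    seq≈ (↭-reflexive (≡-trans (cong (Γ ++_) (collapseAnt-noMarks Δ)) (++-identityʳ Γ))) (collapseSuc-noMarks Δ)

  collapseSuc-noMarks : ∀ Δ → collapseSuc Δ (noMarksList Δ) ≈L Δ
  collapseSuc-noMarks []          = nil≈
  collapseSuc-noMarks (fm A ∷ Δ)  = cons≈ fm≈ (collapseSuc-noMarks Δ)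
  collapseSuc-noMarks (box S ∷ Δ) = cons≈ (box≈ (collapse-noMarks S)) (collapseSuc-noMarks Δ)
  collapseSuc-noMarks (imp S ∷ Δ) = cons≈ (imp≈ (collapse-noMarks S)) (collapseSuc-noMarks Δ)

MarksList-++⁺ : ∀ {Δ Δ'} → MarksList Δ → MarksList Δ' → MarksList (Δ ++ Δ')
MarksList-++⁺ {[]}    _       m' = m'
MarksList-++⁺ {i ∷ Δ} (b , m) m' = b , MarksList-++⁺ m m'

MarksList-++⁻ : ∀ Δ {Δ'} (m : MarksList (Δ ++ Δ'))
              → Σ (MarksList Δ) λ d → Σ (MarksList Δ') λ d' → m ≡ MarksList-++⁺ d d'
MarksList-++⁻ []      m = tt , m , refl
MarksList-++⁻ (i ∷ Δ) (b , m) with MarksList-++⁻ Δ m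
... | d , d' , refl = (b , d) , d' , refl

collapseAnt-++ : ∀ Δ {Δ'} (m : MarksList Δ) (m' : MarksList Δ')
               → collapseAnt (Δ ++ Δ') (MarksList-++⁺ m m') ≡ collapseAnt Δ m ++ collapseAnt Δ' m'
collapseAnt-++ []      m       m' = refl
collapseAnt-++ (i ∷ Δ) (b , m) m' =
  ≡-trans (cong (collapseItemAnt i b ++_) (collapseAnt-++ Δ m m')) (sym (++-assoc (collapseItemAnt i b) _ _))

collapseSuc-++ : ∀ Δ {Δ'} (m : MarksList Δ) (m' : MarksList Δ')
               → collapseSuc (Δ ++ Δ') (MarksList-++⁺ m m') ≡ collapseSuc Δ m ++ collapseSuc Δ' m'
collapseSuc-++ []      m       m' = refl
collapseSuc-++ (i ∷ Δ) (b , m) m' =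
  ≡-trans (cong (collapseItemSuc i b ++_) (collapseSuc-++ Δ m m')) (sym (++-assoc (collapseItemSuc i b) _ _))

data CtxMarks : Ctx → Set where
  hole  : CtxMarks hole
  inBox : ∀ {Γ Δ G} → MarksList Δ → Bool → CtxMarks G → CtxMarks (inBox Γ Δ G)
  inImp : ∀ {Γ Δ G} → MarksList Δ → CtxMarks G → CtxMarks (inImp Γ Δ G)

fillMarks : ∀ {G Y} → CtxMarks G → Marks Y → Marks (fill G Y)
fillMarks hole          m = m
fillMarks (inBox d b g) m = MarksList-++⁺ d ((b , fillMarks g m) , tt)
fillMarks (inImp d g)   m = MarksList-++⁺ d (fillMarks g m , tt)

Marks-fill⁻ : ∀ G X (m : Marks (fill G X)) → Σ (CtxMarks G) λ g → Σ (Marks X) λ mX → m ≡ fillMarks g mX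
Marks-fill⁻ hole X m = hole , m , refl
Marks-fill⁻ (inBox Γ Δ G) X m with MarksList-++⁻ Δ m
... | d , ((b , m₁) , tt) , refl with Marks-fill⁻ G X m₁
...   | g , mX , refl = inBox d b g , mX , refl
Marks-fill⁻ (inImp Γ Δ G) X m with MarksList-++⁻ Δ m
... | d , (m₁ , tt) , refl with Marks-fill⁻ G X m₁
...   | g , mX , refl = inImp d g , mX , refl

collapse-fill : ∀ {G} (g : CtxMarks G) → Σ Ctx λ G' → Σ (List Fml) λ Γ₁ → Σ (List Item) λ Δ₁ →
                ∀ Z m → collapse (fill G Z) (fillMarks g m) ≈S fill G' (extend (collapse Z m) Γ₁ Δ₁)
collapse-fill hole = hole , [] , [] , λ Z m → extend-[] (collapse Z m)
collapse-fill (inImp {Γ} {Δ} d g) with collapse-fill g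
... | G' , Γ₁ , Δ₁ , h = inImp (Γ ++ collapseAnt Δ d) (collapseSuc Δ d) G' , Γ₁ , Δ₁ , λ Z m →
  seq≈ (↭-reflexive (≡-trans (cong (Γ ++_) (collapseAnt-++ Δ d (fillMarks g m , tt)))
                              (≡-trans (sym (++-assoc Γ _ _)) (++-identityʳ _))))
       (trans≈ (≡⇒≈L (collapseSuc-++ Δ d (fillMarks g m , tt)))
               (++⁺ˡ-≈L (collapseSuc Δ d) (cons≈ (imp≈ (h Z m)) nil≈)))
collapse-fill (inBox {Γ} {Δ} d false g) with collapse-fill g
... | G' , Γ₁ , Δ₁ , h = inBox (Γ ++ collapseAnt Δ d) (collapseSuc Δ d) G' , Γ₁ , Δ₁ , λ Z m →
  seq≈ (↭-reflexive (≡-trans (cong (Γ ++_) (collapseAnt-++ Δ d ((false , fillMarks g m) , tt)))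
                              (≡-trans (sym (++-assoc Γ _ _)) (++-identityʳ _))))
       (trans≈ (≡⇒≈L (collapseSuc-++ Δ d ((false , fillMarks g m) , tt)))
               (++⁺ˡ-≈L (collapseSuc Δ d) (cons≈ (box≈ (h Z m)) nil≈)))
collapse-fill (inBox {Γ} {Δ} d true g) with collapse-fill g
... | G₁ , Γ₁ , Δ₁ , h with merge-fill (Γ ++ collapseAnt Δ d) (collapseSuc Δ d) G₁ Γ₁ Δ₁
...   | G' , Γ₂ , Δ₂ , h' = G' , Γ₂ , Δ₂ , λ Z m →
  ≈S-trans (seq≈ (↭-reflexive (≡-trans (cong (Γ ++_) (collapseAnt-++ Δ d ((true , fillMarks g m) , tt)))
                                        (≡-trans (sym (++-assoc Γ _ _)) (cong ((Γ ++ collapseAnt Δ d) ++_) (++-identityʳ _)))))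
                 (trans≈ (≡⇒≈L (collapseSuc-++ Δ d ((true , fillMarks g m) , tt)))
                         (≡⇒≈L (cong (collapseSuc Δ d ++_) (++-identityʳ _)))))
    (≈S-trans (merge-≈ (Γ ++ collapseAnt Δ d) (collapseSuc Δ d) (h Z m)) (h' (collapse Z m)))

mutual
  collapse-≈ : ∀ {S S'} → S ≈S S' → (m' : Marks S') → Σ (Marks S) λ m → collapse S m ≈S collapse S' m'
  collapse-≈ (seq≈ p q) m' with collapseList-≈ q m'
  ... | m , ant≈ , suc≈ = m , seq≈ (++⁺ p ant≈) suc≈

  collapseItem-≈ : ∀ {i j} → i ≈I j → (b' : MarksItem j)
                 → Σ (MarksItem i) λ b → (collapseItemAnt i b ↭ collapseItemAnt j b')
                                        × (collapseItemSuc i b ≈L collapseItemSuc j b')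
  collapseItem-≈ fm≈ b' = tt , ↭-refl , ≈L-refl
  collapseItem-≈ (box≈ p) (false , m') with collapse-≈ p m'
  ... | m , h = (false , m) , ↭-refl , cons≈ (box≈ h) nil≈
  collapseItem-≈ (box≈ p) (true , m') with collapse-≈ p m'
  ... | m , h = (true , m) , antecedent-≈ h , succedent-≈ h
  collapseItem-≈ (imp≈ p) m' with collapse-≈ p m'
  ... | m , h = m , ↭-refl , cons≈ (imp≈ h) nil≈

  collapseList-≈ : ∀ {Δ Δ'} → Δ ≈L Δ' → (m' : MarksList Δ')
                 → Σ (MarksList Δ) λ m → (collapseAnt Δ m ↭ collapseAnt Δ' m')
                                        × (collapseSuc Δ m ≈L collapseSuc Δ' m')
  collapseList-≈ nil≈ m' = tt , ↭-refl , nil≈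
  collapseList-≈ (cons≈ p q) (b' , m') with collapseItem-≈ p b' | collapseList-≈ q m'
  ... | b , a₁ , s₁ | m , a₂ , s₂ = (b , m) , ++⁺ a₁ a₂ , ++⁺-≈L s₁ s₂
  collapseList-≈ (swap≈ {x} {y} {xs}) (b , a , m) =
    (a , b , m) , shifts (collapseItemAnt x a) (collapseItemAnt y b) ,
    shifts-≈L (collapseItemSuc x a) (collapseItemSuc y b) (collapseSuc xs m)
  collapseList-≈ (trans≈ p q) m'' with collapseList-≈ q m''
  ... | m' , a₁ , s₁ with collapseList-≈ p m'
  ...   | m , a₀ , s₀ = m , ↭-trans a₀ a₁ , trans≈ s₀ s₁

flatMarks : ∀ Θ → MarksList Θ → MarksList (flat Θ)
flatMarks []                  _                 = tt
flatMarks (fm A ∷ Θ)          (_ , m)           = flatMarks Θ m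
flatMarks (imp S ∷ Θ)         (_ , m)           = flatMarks Θ m
flatMarks (box (Φ ⇒ Ψ) ∷ Θ)   ((b , mΨ) , m)    = (b , flatMarks Ψ mΨ) , flatMarks Θ m

collapseAnt-flat : ∀ Θ m → collapseAnt (flat Θ) (flatMarks Θ m) ≡ collapseAnt Θ m
collapseAnt-flat [] m = refl
collapseAnt-flat (fm A ∷ Θ)  (_ , m) = collapseAnt-flat Θ m
collapseAnt-flat (imp S ∷ Θ) (_ , m) = collapseAnt-flat Θ m
collapseAnt-flat (box (Φ ⇒ Ψ) ∷ Θ) ((false , mΨ) , m) = collapseAnt-flat Θ m
collapseAnt-flat (box (Φ ⇒ Ψ) ∷ Θ) ((true , mΨ) , m) =
  cong₂ (λ Γ Γ' → (Φ ++ Γ) ++ Γ') (collapseAnt-flat Ψ mΨ) (collapseAnt-flat Θ m)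

collapseSuc-flat : ∀ Θ m → collapseSuc (flat Θ) (flatMarks Θ m) ≡ flat (collapseSuc Θ m)
collapseSuc-flat [] m = refl
collapseSuc-flat (fm A ∷ Θ)  (_ , m) = collapseSuc-flat Θ m
collapseSuc-flat (imp S ∷ Θ) (_ , m) = collapseSuc-flat Θ m
collapseSuc-flat (box (Φ ⇒ Ψ) ∷ Θ) ((false , mΨ) , m) =
  ≡-trans (cong₂ (λ Γ Δ → box (Φ ++ Γ ⇒ Δ) ∷ collapseSuc (flat Θ) (flatMarks Θ m))
                 (collapseAnt-flat Ψ mΨ) (collapseSuc-flat Ψ mΨ))
          (cong (box (Φ ++ collapseAnt Ψ mΨ ⇒ flat (collapseSuc Ψ mΨ)) ∷_) (collapseSuc-flat Θ m))
collapseSuc-flat (box (Φ ⇒ Ψ) ∷ Θ) ((true , mΨ) , m) =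
  ≡-trans (cong₂ _++_ (collapseSuc-flat Ψ mΨ) (collapseSuc-flat Θ m)) (sym (flat-++ (collapseSuc Ψ mΨ) _))

move-to-end : ∀ (Γ Λ Γ₁ Γ₂ : List Fml) → (Γ ++ (Λ ++ Γ₁)) ++ Γ₂ ↭ ((Γ ++ Γ₁) ++ Γ₂) ++ Λ
move-to-end Γ Λ Γ₁ Γ₂ =
  ↭-trans (++⁺ʳ Γ₂ (↭-trans (++⁺ˡ Γ (++-comm Λ Γ₁)) (↭-reflexive (sym (++-assoc Γ Γ₁ Λ)))))
  (↭-trans (↭-reflexive (++-assoc (Γ ++ Γ₁) Λ Γ₂))
  (↭-trans (++⁺ˡ (Γ ++ Γ₁) (++-comm Λ Γ₂)) (↭-reflexive (sym (++-assoc (Γ ++ Γ₁) Γ₂ Λ)))))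

module _ {HasD HasT : Set} where
  private
    Der′ : Seq → Set
    Der′ = Der HasD HasT

  trans-↭ : ∀ {H Γ''} Γ Γ' Σ Π Θ → Γ'' ↭ Γ ++ Γ'
          → Der′ (fill H (Γ'' ⇒ imp (Γ' ++ Σ ⇒ Π) ∷ Θ)) → Der′ (fill H (Γ'' ⇒ imp (Σ ⇒ Π) ∷ Θ))
  trans-↭ {H} Γ Γ' Σ Π Θ π p =
    perm-fill H (seq≈ (↭-sym π) ≈L-refl) (trans {G = H} (perm-fill H (seq≈ π ≈L-refl) p))

  shift-past : ∀ H {Γ I} i Θ Δ → Der′ (fill H (Γ ⇒ I ∷ i ∷ Θ ++ Δ)) → Der′ (fill H (Γ ⇒ I ∷ Θ ++ i ∷ Δ))
  shift-past H i Θ Δ = perm-fill H (seq≈ ↭-refl (cons≈ ≈I-refl (shift-≈L i Θ Δ)))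

  unshift-past : ∀ H {Γ I} i Θ Δ → Der′ (fill H (Γ ⇒ I ∷ Θ ++ i ∷ Δ)) → Der′ (fill H (Γ ⇒ I ∷ i ∷ Θ ++ Δ))
  unshift-past H i Θ Δ = perm-fill H (seq≈ ↭-refl (cons≈ ≈I-refl (≈L-sym (shift-≈L i Θ Δ))))

  inter→* : ∀ {H Γ Σ Π} Θ Δ → Der′ (fill H (Γ ⇒ imp (Σ ⇒ flat Θ ++ Π) ∷ Θ ++ Δ))
          → Der′ (fill H (Γ ⇒ imp (Σ ⇒ Π) ∷ Θ ++ Δ))
  inter→* [] Δ p = p
  inter→* {H} (fm A ∷ Θ) Δ p =
    unshift-past H (fm A) Θ Δ (inter→* Θ (fm A ∷ Δ) (shift-past H (fm A) Θ Δ p))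
  inter→* {H} (imp S ∷ Θ) Δ p =
    unshift-past H (imp S) Θ Δ (inter→* Θ (imp S ∷ Δ) (shift-past H (imp S) Θ Δ p))
  inter→* {H} {Σ = Σ} {Π} (box (Φ ⇒ Ψ) ∷ Θ) Δ p =
    inter→ {G = H} (unshift-past H (box (Φ ⇒ Ψ)) Θ Δ (inter→* Θ (box (Φ ⇒ Ψ) ∷ Δ)
      (perm-fill H (seq≈ ↭-refl (cons≈ (imp≈ (seq≈ ↭-refl (shift-≈L (box (Φ ⇒ flat Ψ)) (flat Θ) Π)))
                                       (shift-≈L (box (Φ ⇒ Ψ)) Θ Δ))) p)))

  -- What (inter→) becomes once its modal block [Λ ⇒ Θ] is merged into the parent: (trans) carries Λ into
  -- the implication block, and (inter→) each modal block of Θ.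
  inter→-merged : ∀ {H Γ''} Γ Λ Σ Π Θ Δ → Γ'' ↭ Γ ++ Λ
                → Der′ (fill H (Γ'' ⇒ imp (Λ ++ Σ ⇒ flat Θ ++ Π) ∷ Θ ++ Δ))
                → Der′ (fill H (Γ'' ⇒ imp (Σ ⇒ Π) ∷ Θ ++ Δ))
  inter→-merged Γ Λ Σ Π Θ Δ π p = trans-↭ Γ Λ Σ Π (Θ ++ Δ) π (inter→* Θ Δ p)

module _ {HasD HasD' HasT : Set} (t : HasT) where
  private
    Der′ : Seq → Set
    Der′ = Der HasD' HasT

  collapse-axiom : ∀ {G X} (g : CtxMarks G) (mX : Marks X)
                 → (∀ Γ₁ Δ₁ {H} → Der′ (fill H (extend (collapse X mX) Γ₁ Δ₁)))
                 → Der′ (collapse (fill G X) (fillMarks g mX))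
  collapse-axiom {X = X} g mX ax with collapse-fill g
  ... | G' , Γ₁ , Δ₁ , h = perm (≈S-sym (h X mX)) (ax Γ₁ Δ₁)

  collapse-rule₁ : ∀ {G X Y} (g : CtxMarks G) (mX : Marks X) (mY : Marks Y)
                 → (∀ Γ₁ Δ₁ {H} → Der′ (fill H (extend (collapse Y mY) Γ₁ Δ₁))
                                → Der′ (fill H (extend (collapse X mX) Γ₁ Δ₁)))
                 → Der′ (collapse (fill G Y) (fillMarks g mY)) → Der′ (collapse (fill G X) (fillMarks g mX))
  collapse-rule₁ {X = X} {Y} g mX mY rule p with collapse-fill g
  ... | G' , Γ₁ , Δ₁ , h = perm (≈S-sym (h X mX)) (rule Γ₁ Δ₁ (perm (h Y mY) p))

  collapse-rule₂ : ∀ {G X Y Z} (g : CtxMarks G) (mX : Marks X) (mY : Marks Y) (mZ : Marks Z)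
                 → (∀ Γ₁ Δ₁ {H} → Der′ (fill H (extend (collapse Y mY) Γ₁ Δ₁))
                                → Der′ (fill H (extend (collapse Z mZ) Γ₁ Δ₁))
                                → Der′ (fill H (extend (collapse X mX) Γ₁ Δ₁)))
                 → Der′ (collapse (fill G Y) (fillMarks g mY)) → Der′ (collapse (fill G Z) (fillMarks g mZ))
                 → Der′ (collapse (fill G X) (fillMarks g mX))
  collapse-rule₂ {X = X} {Y} {Z} g mX mY mZ rule p q with collapse-fill g
  ... | G' , Γ₁ , Δ₁ , h = perm (≈S-sym (h X mX)) (rule Γ₁ Δ₁ (perm (h Y mY) p) (perm (h Z mZ) q))

  collapse-admissible : ∀ {S} → Der HasD HasT S → (m : Marks S) → Der′ (collapse S m)
  collapse-admissible (ax⊥ {G} {Γ} {Δ}) m with Marks-fill⁻ G (bot ∷ Γ ⇒ Δ) m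
  ... | g , mX , refl = collapse-axiom g mX (λ _ _ {H} → ax⊥ {G = H})
  collapse-admissible (ax⊤ {G} {Γ} {Δ}) m with Marks-fill⁻ G (Γ ⇒ fm top ∷ Δ) m
  ... | g , (tt , mX) , refl = collapse-axiom g (tt , mX) (λ _ _ {H} → ax⊤ {G = H})
  collapse-admissible (axp {G} {Γ} {Δ} {p}) m with Marks-fill⁻ G (atom p ∷ Γ ⇒ fm (atom p) ∷ Δ) m
  ... | g , (tt , mX) , refl = collapse-axiom g (tt , mX) (λ _ _ {H} → axp {G = H})
  collapse-admissible (∧L {G} {Γ} {Δ} {A} {B} p) m with Marks-fill⁻ G (A ∧ B ∷ Γ ⇒ Δ) m
  ... | g , mX , refl = collapse-rule₁ g mX mX (λ _ _ {H} → ∧L {G = H}) (collapse-admissible p _)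
  collapse-admissible (∧R {G} {Γ} {Δ} {A} {B} p q) m with Marks-fill⁻ G (Γ ⇒ fm (A ∧ B) ∷ Δ) m
  ... | g , (tt , mX) , refl = collapse-rule₂ g (tt , mX) (tt , mX) (tt , mX) (λ _ _ {H} → ∧R {G = H})
                                 (collapse-admissible p _) (collapse-admissible q _)
  collapse-admissible (∨L {G} {Γ} {Δ} {A} {B} p q) m with Marks-fill⁻ G (A ∨ B ∷ Γ ⇒ Δ) m
  ... | g , mX , refl = collapse-rule₂ g mX mX mX (λ _ _ {H} → ∨L {G = H})
                          (collapse-admissible p _) (collapse-admissible q _)
  collapse-admissible (∨R {G} {Γ} {Δ} {A} {B} p) m with Marks-fill⁻ G (Γ ⇒ fm (A ∨ B) ∷ Δ) m
  ... | g , (tt , mX) , refl = collapse-rule₁ g (tt , mX) (tt , tt , mX) (λ _ _ {H} → ∨R {G = H}) (collapse-admissible p _)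
  collapse-admissible (⊃L {G} {Γ} {Δ} {A} {B} p q) m with Marks-fill⁻ G ((A ⊃ B) ∷ Γ ⇒ Δ) m
  ... | g , mX , refl = collapse-rule₂ g mX (tt , mX) mX (λ _ _ {H} → ⊃L {G = H})
                          (collapse-admissible p _) (collapse-admissible q _)
  collapse-admissible (⊃R {G} {Γ} {Δ} {A} {B} p) m with Marks-fill⁻ G (Γ ⇒ fm (A ⊃ B) ∷ Δ) m
  ... | g , (tt , mX) , refl = collapse-rule₁ g (tt , mX) ((tt , tt) , mX) (λ _ _ {H} → ⊃R {G = H}) (collapse-admissible p _)
  collapse-admissible (□R {G} {Γ} {Δ} {A} p) m with Marks-fill⁻ G (Γ ⇒ fm (□ A) ∷ Δ) m
  ... | g , (tt , mX) , refl = collapse-rule₁ {Y = Γ ⇒ box ([] ⇒ fm A ∷ []) ∷ Δ} g (tt , mX) ((false , tt , tt) , mX)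
                                 (λ _ _ {H} → □R {G = H}) (collapse-admissible p _)
  collapse-admissible (◇L {G} {Γ} {Δ} {A} p) m with Marks-fill⁻ G ((◇ A) ∷ Γ ⇒ Δ) m
  ... | g , mX , refl = collapse-rule₁ {Y = Γ ⇒ box (A ∷ [] ⇒ []) ∷ Δ} g mX ((false , tt) , mX)
                          (λ _ _ {H} → ◇L {G = H}) (collapse-admissible p _)
  collapse-admissible (T□ {G} {Γ} {Δ} {A} _ p) m with Marks-fill⁻ G ((□ A) ∷ Γ ⇒ Δ) m
  ... | g , mX , refl = collapse-rule₁ g mX mX (λ _ _ {H} → T□ {G = H} t) (collapse-admissible p _)
  collapse-admissible (T◇ {G} {Γ} {Δ} {A} _ p) m with Marks-fill⁻ G (Γ ⇒ fm (◇ A) ∷ Δ) m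
  ... | g , (tt , mX) , refl = collapse-rule₁ g (tt , mX) (tt , tt , mX) (λ _ _ {H} → T◇ {G = H} t) (collapse-admissible p _)
  collapse-admissible (D {G} {Γ} {Δ} _ p) m with Marks-fill⁻ G (Γ ⇒ Δ) m
  ... | g , mX , refl = collapse-rule₁ {Y = Γ ⇒ box ([] ⇒ []) ∷ Δ} g mX ((true , tt) , mX) (λ _ _ q → q)
                          (collapse-admissible p _)
  collapse-admissible (□L {G} {Γ} {Δ} {Σ} {Π} {A} p) m with Marks-fill⁻ G ((□ A) ∷ Γ ⇒ box (Σ ⇒ Π) ∷ Δ) m
  ... | g , ((false , mΠ) , mX) , refl =
    collapse-rule₁ g ((false , mΠ) , mX) ((false , mΠ) , mX) (λ _ _ {H} → □L {G = H}) (collapse-admissible p _)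
  ... | g , ((true , mΠ) , mX) , refl =
    collapse-rule₁ g ((true , mΠ) , mX) ((true , mΠ) , mX)
      (λ Γ₁ _ {H} q → T□ {G = H} t (perm-fill H (seq≈ (prep (□ A) (++⁺ʳ Γ₁ (shift A Γ _))) ≈L-refl) q))
      (collapse-admissible p _)
  collapse-admissible (◇R {G} {Γ} {Δ} {Σ} {Π} {A} p) m with Marks-fill⁻ G (Γ ⇒ fm (◇ A) ∷ box (Σ ⇒ Π) ∷ Δ) m
  ... | g , (tt , (false , mΠ) , mX) , refl =
    collapse-rule₁ g (tt , (false , mΠ) , mX) (tt , (false , tt , mΠ) , mX) (λ _ _ {H} → ◇R {G = H}) (collapse-admissible p _)
  ... | g , (tt , (true , mΠ) , mX) , refl =
    collapse-rule₁ g (tt , (true , mΠ) , mX) (tt , (true , tt , mΠ) , mX) (λ _ _ {H} → T◇ {G = H} t) (collapse-admissible p _)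
  collapse-admissible (trans {G} {Γ} {Γ'} {Δ} {Σ} {Π} p) m with Marks-fill⁻ G (Γ ++ Γ' ⇒ imp (Σ ⇒ Π) ∷ Δ) m
  ... | g , (mΠ , mX) , refl =
    collapse-rule₁ g (mΠ , mX) (mΠ , mX)
      (λ Γ₁ Δ₁ {H} q → trans-↭ {H = H} ((Γ ++ collapseAnt Δ mX) ++ Γ₁) Γ' _ _ _
        (↭-trans (++⁺ʳ Γ₁ (↭-reflexive (++-assoc Γ Γ' _))) (move-to-end Γ Γ' (collapseAnt Δ mX) Γ₁))
        (perm-fill H (seq≈ ↭-refl (cons≈ (imp≈ (seq≈ (↭-reflexive (++-assoc Γ' Σ _)) ≈L-refl)) ≈L-refl)) q))
      (collapse-admissible p _)
  collapse-admissible (inter→ {G} {Γ} {Δ} {Σ} {Π} {Λ} {Θ} p) m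
    with Marks-fill⁻ G (Γ ⇒ imp (Σ ⇒ Π) ∷ box (Λ ⇒ Θ) ∷ Δ) m
  ... | g , (mΠ , (false , mΘ) , mX) , refl =
    collapse-rule₁ g (mΠ , (false , mΘ) , mX) (((false , flatMarks Θ mΘ) , mΠ) , (false , mΘ) , mX)
      (λ Γ₁ Δ₁ {H} q → inter→ {G = H}
        (subst (λ S → Der′ (fill H S))
          (cong₂ (λ Φ Ψ → (Γ ++ collapseAnt Δ mX) ++ Γ₁
                          ⇒ imp (Σ ++ collapseAnt Π mΠ ⇒ box (Λ ++ Φ ⇒ Ψ) ∷ collapseSuc Π mΠ)
                          ∷ box (Λ ++ collapseAnt Θ mΘ ⇒ collapseSuc Θ mΘ) ∷ collapseSuc Δ mX ++ Δ₁)
                 (collapseAnt-flat Θ mΘ) (collapseSuc-flat Θ mΘ)) q))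
      (collapse-admissible p _)
  ... | g , (mΠ , (true , mΘ) , mX) , refl =
    collapse-rule₁ g (mΠ , (true , mΘ) , mX) (((true , flatMarks Θ mΘ) , mΠ) , (true , mΘ) , mX)
      (λ Γ₁ Δ₁ {H} q →
        perm-fill H (seq≈ ↭-refl (cons≈ ≈I-refl (≡⇒≈L (sym (++-assoc (collapseSuc Θ mΘ) _ _)))))
          (inter→-merged {H = H} ((Γ ++ collapseAnt Δ mX) ++ Γ₁) (Λ ++ collapseAnt Θ mΘ) _ _
                         (collapseSuc Θ mΘ) (collapseSuc Δ mX ++ Δ₁)
            (move-to-end Γ (Λ ++ collapseAnt Θ mΘ) (collapseAnt Δ mX) Γ₁)
            (perm-fill H (seq≈ ↭-refl (cons≈ (imp≈ (seq≈ (shifts Σ (Λ ++ collapseAnt Θ mΘ)) ≈L-refl))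
                                             (≡⇒≈L (++-assoc (collapseSuc Θ mΘ) _ _))))
              (subst (λ S → Der′ (fill H S))
                (cong₂ (λ Φ Ψ → (Γ ++ ((Λ ++ collapseAnt Θ mΘ) ++ collapseAnt Δ mX)) ++ Γ₁
                                ⇒ imp (Σ ++ ((Λ ++ Φ) ++ collapseAnt Π mΠ) ⇒ Ψ ++ collapseSuc Π mΠ)
                                ∷ (collapseSuc Θ mΘ ++ collapseSuc Δ mX) ++ Δ₁)
                       (collapseAnt-flat Θ mΘ) (collapseSuc-flat Θ mΘ)) q))))
      (collapse-admissible p _)
  collapse-admissible (perm S≈S' p) m' with collapse-≈ S≈S' m'
  ... | m , collapse≈ = perm collapse≈ (collapse-admissible p m)

  D-admissible : ∀ {S} → Der HasD HasT S → Der HasD' HasT S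
  D-admissible {S} p = perm (collapse-noMarks S) (collapse-admissible p (noMarks S))

Der-with-D⇒Prov : ∀ L {S} → Der ⊤ (L ≡ LIKT) S → Prov L S
Der-with-D⇒Prov LIKD = Der⇒Prov ∘ Der-map (λ _ → refl) id
Der-with-D⇒Prov LIKT = Der⇒Prov ∘ D-admissible refl

proposition4 : (L : Logic) (A B : Fml)
    → Prov L ([] ⇒ fm (A ∨ B) ∷ [])
    → Prov L ([] ⇒ fm A ∷ []) ⊎ Prov L ([] ⇒ fm B ∷ [])
proposition4 L A B p with restriction (Prov⇒Der p) (inj₂ disj , tt)
... | left  , q = inj₁ (Der-with-D⇒Prov L q)
... | right , q = inj₂ (Der-with-D⇒Prov L q)
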